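{- Let $\pi=\pi_1\cdots\pi_n\in\mathfrak S_n$ and write $\pi=\pi^{(1)}\pi'$ where $\pi^{(1)}=\pi_1\cdots\pi_{i_\pi}$ is a permutation of $\{1,\dots,i_\pi\}$ and $\pi'=\pi_{i_\pi+1}\cdots\pi_n$. Then $\pi$ is a $1\underline{23}$-avoiding decomposable permutation if and only if $1\le i_\pi\le n-1$, $\pi_{i_\pi}=1$ (so $\pi^{(1)}=\pi_1\cdots\pi_{i_\pi-1}1$) where $\pi_1\cdots\pi_{i_\pi-1}$ is a $1\underline{23}$-avoiding permutation of $\{2,3,\dots,i_\pi\}$, and $\pi'=n(n-1)\cdots(i_\pi+1)$.
   Context: For a permutation $\pi=\pi_1\cdots\pi_n$ of $[n]$, $i_\pi$ is the smallest index $i$ with $\{\pi_1,\dots,\pi_i\}=\{1,\dots,i\}$; $\pi$ is indecomposable if $i_\pi=n$ and decomposable otherwise. A sequence $\pi$ of distinct integers contains the vincular pattern $1\underline{23}$ if there are indices $j<k$ (with $k+1$ a valid index) such that $\pi_j<\pi_k<\pi_{k+1}$; otherwise it avoids $1\underline{23}$. -}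

module Defs where

open import Data.Nat using (ℕ; zero; suc; _+_; _∸_; _≤_; _<_)
open import Data.List using (List; []; _∷_; map; upTo; take; drop; reverse; length)
open import Data.List.Relation.Binary.Permutation.Propositional using (_↭_)
open import Data.Product using (Σ; _×_; ∃-syntax)
open import Relation.Binary.PropositionalEquality using (_≡_; _≢_)
open import Relation.Nullary using (¬_)

interval : ℕ → ℕ → List ℕ
interval a m = map (λ k → suc (a + k)) (upTo m)

IsPerm : ℕ → List ℕ → Set
IsPerm n π = π ↭ interval 0 n

-- 0-based lookup with default 0 (only used at valid indices)
at : List ℕ → ℕ → ℕ
at []       _       = 0
at (x ∷ xs) zero    = x
at (x ∷ xs) (suc k) = at xs k

PrefixIsBlock : List ℕ → ℕ → Set
PrefixIsBlock π i = take i π ↭ interval 0 i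

IsFirstBlockEnd : List ℕ → ℕ → Set
IsFirstBlockEnd π i =
  (1 ≤ i) × PrefixIsBlock π i × (∀ j → 1 ≤ j → j < i → ¬ PrefixIsBlock π j)

-- π contains the vincular pattern 1-23 (0-based positions j < k, k+1 valid)
Contains123 : List ℕ → Set
Contains123 π = ∃[ j ] ∃[ k ]
  (j < k × suc k < length π × at π j < at π k × at π k < at π (suc k))

Avoids123 : List ℕ → Set
Avoids123 π = ¬ Contains123 π

-- Split π = A ++ y ∷ D with A ∷ʳ y the first block. Every entry of the first
-- block is smaller than every entry of D, so in a 1-23-avoider nothing before y
-- may lie below y (else it, y and the head of D form the pattern), and D may not
-- ascend (else y and the ascent form it); hence y = 1 and D is [n, n-1, …, i+1].
-- Conversely, in A ++ 1 ∷ D with D decreasing, an ascent either lies inside A,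
-- or ends or starts at 1 (impossible, nothing lies below 1), or lies inside D.
module Submission where

open import Defs
open import Data.Nat using (ℕ; zero; suc; _+_; _∸_; _≤_; _<_; _≥_; z≤n; s≤s; s≤s⁻¹)
open import Data.Nat.Properties
open import Data.List using (List; []; _∷_; _++_; _∷ʳ_; length; take; drop; reverse; applyUpTo)
open import Data.List.Properties using (length-applyUpTo; map-upTo; reverse-applyUpTo; length-take; length-++-≤ˡ; take++drop≡id)
open import Data.List.Membership.Propositional using (_∈_)
open import Data.List.Membership.Propositional.Properties using (∈-applyUpTo⁻; ∈-++⁺ʳ)
open import Data.List.Relation.Unary.Any using (here; there)
open import Data.List.Relation.Unary.All as All using (All)
open import Data.List.Relation.Unary.All.Properties using (∷ʳ⁺)
open import Data.List.Relation.Unary.Linked using (Linked; []; [-]; _∷_)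
open import Data.List.Relation.Unary.Linked.Properties using (applyDownFrom⁺₂)
open import Data.List.Relation.Unary.Sorted.TotalOrder.Properties using (↗↭↗⇒≋)
open import Data.List.Relation.Binary.Pointwise using (Pointwise-≡⇒≡)
open import Data.List.Relation.Binary.Permutation.Propositional using (_↭_; ↭-sym; ↭-trans; ↭⇒↭ₛ′; module PermutationReasoning)
open import Data.List.Relation.Binary.Permutation.Propositional.Properties using (↭-length; drop-∷; ++⁺ʳ; ↭-reverse; ∈-resp-↭; ∷↭∷ʳ)
open import Data.Product using (_×_; _,_; proj₁; proj₂; ∃-syntax)
open import Data.Sum using (inj₁; inj₂)
open import Function using (_∘_)
open import Function.Bundles using (_⇔_; mk⇔)
open import Relation.Binary.Bundles using (TotalOrder)
import Relation.Binary.Properties.TotalOrder as TotalOrderProperties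
open import Relation.Binary.PropositionalEquality using (_≡_; _≢_; refl; sym; trans; cong; cong₂; subst; subst₂; module ≡-Reasoning)
open import Relation.Nullary using (¬_; yes; no)

private
  variable
    A : Set
    x y : ℕ
    xs ys : List ℕ

applyUpTo-cong : ∀ {f g : ℕ → A} → (∀ k → f k ≡ g k) → ∀ r → applyUpTo f r ≡ applyUpTo g r
applyUpTo-cong f≗g zero    = refl
applyUpTo-cong f≗g (suc r) = cong₂ _∷_ (f≗g 0) (applyUpTo-cong (f≗g ∘ suc) r)

applyUpTo-++ : ∀ (f : ℕ → A) r s → applyUpTo f (r + s) ≡ applyUpTo f r ++ applyUpTo (λ k → f (r + k)) s
applyUpTo-++ f zero    s = refl
applyUpTo-++ f (suc r) s = cong (f 0 ∷_) (applyUpTo-++ (f ∘ suc) r s)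

interval≡applyUpTo : ∀ a r → interval a r ≡ applyUpTo (λ k → suc (a + k)) r
interval≡applyUpTo a = map-upTo (λ k → suc (a + k))

length-interval : ∀ a r → length (interval a r) ≡ r
length-interval a r = trans (cong length (interval≡applyUpTo a r)) (length-applyUpTo _ r)

∈-interval⁻ : ∀ a r → x ∈ interval a r → a < x × x ≤ a + r
∈-interval⁻ a r x∈
  with k , k<r , refl ← ∈-applyUpTo⁻ _ (subst (_ ∈_) (interval≡applyUpTo a r) x∈)
  = s≤s (m≤m+n a k) , +-monoʳ-< a k<r

interval-++ : ∀ a r s → interval a (r + s) ≡ interval a r ++ interval (a + r) s
interval-++ a r s = begin
  interval a (r + s)                              ≡⟨ interval≡applyUpTo a (r + s) ⟩
  applyUpTo f (r + s)                             ≡⟨ applyUpTo-++ f r s ⟩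
  applyUpTo f r ++ applyUpTo (λ k → f (r + k)) s  ≡⟨ cong₂ _++_ (sym (interval≡applyUpTo a r)) shifted ⟩
  interval a r ++ interval (a + r) s              ∎
  where
  open ≡-Reasoning
  f : ℕ → ℕ
  f k = suc (a + k)
  shifted : applyUpTo (λ k → f (r + k)) s ≡ interval (a + r) s
  shifted = trans (applyUpTo-cong (λ k → cong suc (sym (+-assoc a r k))) s)
                  (sym (interval≡applyUpTo (a + r) s))

reverse-interval-nonincreasing : ∀ a r → Linked _≥_ (reverse (interval a r))
reverse-interval-nonincreasing a r =
  subst (Linked _≥_) (sym (trans (cong reverse (interval≡applyUpTo a r)) (reverse-applyUpTo _ r)))
    (applyDownFrom⁺₂ _ r (λ k → s≤s (+-monoʳ-≤ a (n≤1+n k))))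

++-cancelˡ-↭ : ∀ (xs : List A) {ys zs} → xs ++ ys ↭ xs ++ zs → ys ↭ zs
++-cancelˡ-↭ []       p = p
++-cancelˡ-↭ (x ∷ xs) p = ++-cancelˡ-↭ xs (drop-∷ p)

nonincreasing-↭⇒≡ : Linked _≥_ xs → Linked _≥_ ys → xs ↭ ys → xs ≡ ys
nonincreasing-↭⇒≡ xs≥ ys≥ xs↭ys =
  Pointwise-≡⇒≡ (↗↭↗⇒≋ ≥-totalOrder xs≥ ys≥ (↭⇒↭ₛ′ (TotalOrder.Eq.isEquivalence ≥-totalOrder) xs↭ys))
  where open TotalOrderProperties ≤-totalOrder using (≥-totalOrder)

at-++ˡ : ∀ xs {ys p} → p < length xs → at (xs ++ ys) p ≡ at xs p
at-++ˡ (x ∷ xs) {p = zero}  _         = refl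
at-++ˡ (x ∷ xs) {p = suc p} (s≤s p<n) = at-++ˡ xs p<n

at-++ʳ : ∀ xs {ys} p → at (xs ++ ys) (length xs + p) ≡ at ys p
at-++ʳ []       p = refl
at-++ʳ (x ∷ xs) p = at-++ʳ xs p

at∈ : ∀ xs {p} → p < length xs → at xs p ∈ xs
at∈ (x ∷ xs) {zero}  _         = here refl
at∈ (x ∷ xs) {suc p} (s≤s p<n) = there (at∈ xs p<n)

∈⇒at : x ∈ xs → ∃[ p ] p < length xs × at xs p ≡ x
∈⇒at (here refl) = 0 , s≤s z≤n , refl
∈⇒at (there x∈) with p , p<n , eq ← ∈⇒at x∈ = suc p , s≤s p<n , eq

All-at : ∀ {P : ℕ → Set} {p} → All P xs → p < length xs → P (at xs p)
All-at {xs} P[xs] p<n = All.lookup P[xs] (at∈ xs p<n)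

take-suc-at : ∀ {p} → p < length xs → take (suc p) xs ≡ take p xs ∷ʳ at xs p
take-suc-at {x ∷ xs} {zero}  _         = refl
take-suc-at {x ∷ xs} {suc p} (s≤s p<n) = cong (x ∷_) (take-suc-at p<n)

take-at-drop : ∀ {p} → p < length xs → xs ≡ take p xs ++ at xs p ∷ drop (suc p) xs
take-at-drop {x ∷ xs} {zero}  _         = refl
take-at-drop {x ∷ xs} {suc p} (s≤s p<n) = cong (x ∷_) (take-at-drop p<n)

record Ascent (xs : List ℕ) (k : ℕ) : Set where
  constructor ascent
  field
    bound  : suc k < length xs
    rising : at xs k < at xs (suc k)

contains123 : ∀ {j k} → j < k → at xs j < at xs k → Ascent xs k → Contains123 xs
contains123 j<k lt (ascent bound asc) = _ , _ , j<k , bound , lt , asc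

ascent-++ˡ : ∀ xs {ys k} → Ascent xs k → Ascent (xs ++ ys) k
ascent-++ˡ xs (ascent bound asc) = ascent
  (<-≤-trans bound (length-++-≤ˡ xs))
  (subst₂ _<_ (sym (at-++ˡ xs (<-trans (n<1+n _) bound))) (sym (at-++ˡ xs bound)) asc)

ascent-++ˡ⁻ : ∀ xs {ys k} → suc k < length xs → Ascent (xs ++ ys) k → Ascent xs k
ascent-++ˡ⁻ xs bound (ascent _ asc) =
  ascent bound (subst₂ _<_ (at-++ˡ xs (<-trans (n<1+n _) bound)) (at-++ˡ xs bound) asc)

ascent-++ʳ : ∀ xs {ys} k → Ascent ys k → Ascent (xs ++ ys) (length xs + k)
ascent-++ʳ []       k asc = asc
ascent-++ʳ (x ∷ xs) k asc with ascent bound lt ← ascent-++ʳ xs k asc = ascent (s≤s bound) lt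

ascent-++ʳ⁻ : ∀ xs {ys} k → Ascent (xs ++ ys) (length xs + k) → Ascent ys k
ascent-++ʳ⁻ []       k asc                    = asc
ascent-++ʳ⁻ (x ∷ xs) k (ascent (s≤s bound) lt) = ascent-++ʳ⁻ xs k (ascent bound lt)

nonincreasing⇒¬ascent : ∀ {k} → Linked _≥_ xs → ¬ Ascent xs k
nonincreasing⇒¬ascent {k = zero}  (x≥y ∷ _)  (ascent _ x<y)          = <⇒≱ x<y x≥y
nonincreasing⇒¬ascent {k = suc k} (_ ∷ ≥ys) (ascent (s≤s bound) lt) =
  nonincreasing⇒¬ascent ≥ys (ascent bound lt)

¬ascent⇒nonincreasing : (∀ k → ¬ Ascent xs k) → Linked _≥_ xs
¬ascent⇒nonincreasing {[]}         _ = []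
¬ascent⇒nonincreasing {x ∷ []}     _ = [-]
¬ascent⇒nonincreasing {x ∷ y ∷ xs} ¬asc =
  ≮⇒≥ (λ x<y → ¬asc 0 (ascent (s≤s (s≤s z≤n)) x<y)) ∷
  ¬ascent⇒nonincreasing (λ k (ascent bound lt) → ¬asc (suc k) (ascent (s≤s bound) lt))

contains-++ˡ : ∀ xs {ys} → Contains123 xs → Contains123 (xs ++ ys)
contains-++ˡ xs (j , k , j<k , bound , lt , asc) =
  contains123 j<k (subst₂ _<_ (sym (at-++ˡ xs (<-trans j<k k<n))) (sym (at-++ˡ xs k<n)) lt)
              (ascent-++ˡ xs (ascent bound asc))
  where
  k<n : k < length xs
  k<n = <-trans (n<1+n k) bound

avoids⇒≤-before : ∀ xs → 0 < length ys → All (y <_) ys → Avoids123 (xs ++ y ∷ ys) → All (y ≤_) xs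
avoids⇒≤-before xs 0<|ys| y<ys avoid = All.tabulate λ x∈xs →
  let p , p<n , at≡x = ∈⇒at x∈xs in
  ≮⇒≥ λ x<y → avoid (contains123 (≤-trans p<n (m≤m+n _ 0))
    (subst₂ _<_ (sym (trans (at-++ˡ xs p<n) at≡x)) (sym (at-++ʳ xs 0)) x<y)
    (ascent-++ʳ xs 0 (ascent (s≤s 0<|ys|) (All-at y<ys 0<|ys|))))

avoids⇒nonincreasing-after : ∀ xs → All (y <_) ys → Avoids123 (xs ++ y ∷ ys) → Linked _≥_ ys
avoids⇒nonincreasing-after xs y<ys avoid = ¬ascent⇒nonincreasing λ q (ascent bound lt) →
  avoid (contains123 (+-monoʳ-< (length xs) (s≤s z≤n))
    (subst₂ _<_ (sym (at-++ʳ xs 0)) (sym (at-++ʳ xs (suc q))) (All-at y<ys (<-trans (n<1+n q) bound)))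
    (ascent-++ʳ xs (suc q) (ascent (s≤s bound) lt)))

avoids-++-∷⁻ : ∀ xs → 0 < length ys → All (y <_) ys → Avoids123 (xs ++ y ∷ ys) →
               Avoids123 xs × All (y ≤_) xs × Linked _≥_ ys
avoids-++-∷⁻ xs 0<|ys| y<ys avoid =
  avoid ∘ contains-++ˡ xs , avoids⇒≤-before xs 0<|ys| y<ys avoid , avoids⇒nonincreasing-after xs y<ys avoid

avoids-++-∷⁺ : Avoids123 xs → All (y ≤_) xs → Linked _≥_ ys → Avoids123 (xs ++ y ∷ ys)
avoids-++-∷⁺ {xs} {y} {ys} avoid y≤xs ys≥ (j , k , j<k , bound , lt , asc) with k <? length xs
... | yes k<n with m≤n⇒m<n∨m≡n k<n
...   | inj₁ 1+k<n = avoid (contains123 j<k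
          (subst₂ _<_ (at-++ˡ xs (<-trans j<k k<n)) (at-++ˡ xs k<n) lt)
          (ascent-++ˡ⁻ xs 1+k<n (ascent bound asc)))
...   | inj₂ 1+k≡n = <⇒≱ (subst (at (xs ++ y ∷ ys) k <_) at[1+k]≡y asc)
          (subst (y ≤_) (sym (at-++ˡ xs k<n)) (All-at y≤xs k<n))
  where
  at[1+k]≡y : at (xs ++ y ∷ ys) (suc k) ≡ y
  at[1+k]≡y = trans (cong (at (xs ++ y ∷ ys)) (trans 1+k≡n (sym (+-identityʳ _)))) (at-++ʳ xs {y ∷ ys} 0)
avoids-++-∷⁺ {xs} {y} {ys} avoid y≤xs ys≥ (j , k , j<k , bound , lt , asc) | no k≮n
  with m≤n⇒∃[o]m+o≡n (≮⇒≥ k≮n)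
... | zero  , refl = <⇒≱ (subst (at (xs ++ y ∷ ys) j <_) (at-++ʳ xs 0) lt)
        (subst (y ≤_) (sym (at-++ˡ xs j<n)) (All-at y≤xs j<n))
  where
  j<n : j < length xs
  j<n = subst (j <_) (+-identityʳ _) j<k
... | suc q , refl with ascent bound′ lt′ ← ascent-++ʳ⁻ xs (suc q) (ascent bound asc) =
  nonincreasing⇒¬ascent ys≥ (ascent (s≤s⁻¹ bound′) lt′)

prefixIsBlock⇒≤length : ∀ {π i} → PrefixIsBlock π i → i ≤ length π
prefixIsBlock⇒≤length {π} {i} block =
  m⊓n≡m⇒m≤n (trans (sym (length-take i π)) (trans (↭-length block) (length-interval 0 i)))

suffix-↭-interval : ∀ {n π i} → IsPerm n π → PrefixIsBlock π i → i ≤ n → drop i π ↭ interval i (n ∸ i)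
suffix-↭-interval {n} {π} {i} perm block i≤n = ++-cancelˡ-↭ (interval 0 i) (begin
  interval 0 i ++ drop i π            ↭⟨ ++⁺ʳ (drop i π) (↭-sym block) ⟩
  take i π ++ drop i π                ≡⟨ take++drop≡id i π ⟩
  π                                   ↭⟨ perm ⟩
  interval 0 n                        ≡⟨ cong (interval 0) (sym (m+[n∸m]≡n i≤n)) ⟩
  interval 0 (i + (n ∸ i))            ≡⟨ interval-++ 0 i (n ∸ i) ⟩
  interval 0 i ++ interval i (n ∸ i)  ∎)
  where open PermutationReasoning

avoider-block-decomposition : ∀ {m r} →
  xs ∷ʳ y ↭ interval 0 (suc m) → ys ↭ interval (suc m) r → 0 < r → Avoids123 (xs ++ y ∷ ys) →
  y ≡ 1 × xs ↭ interval 1 m × Avoids123 xs × ys ≡ reverse (interval (suc m) r)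
avoider-block-decomposition {xs} {y} {ys} {m} {r} block ys↭ 0<r avoid
  = let avoid-xs , y≤xs , ys≥ = avoids-++-∷⁻ xs 0<|ys| y<ys avoid
        y≡1 = least⇒≡1 y≤xs
    in y≡1 , drop-∷ (↭-trans (∷↭∷ʳ 1 xs) (subst (λ z → xs ∷ʳ z ↭ _) y≡1 block′)) , avoid-xs ,
       nonincreasing-↭⇒≡ ys≥ (reverse-interval-nonincreasing (suc m) r) (↭-trans ys↭ (↭-sym (↭-reverse _)))
  where
  block′ : xs ∷ʳ y ↭ 1 ∷ interval 1 m
  block′ = subst (xs ∷ʳ y ↭_) (interval-++ 0 1 m) block
  y-bounds : 0 < y × y ≤ suc m
  y-bounds = ∈-interval⁻ 0 (suc m) (∈-resp-↭ block (∈-++⁺ʳ xs (here refl)))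
  y<ys : All (y <_) ys
  y<ys = All.tabulate λ z∈ys →
    ≤-<-trans (proj₂ y-bounds) (proj₁ (∈-interval⁻ (suc m) r (∈-resp-↭ ys↭ z∈ys)))
  0<|ys| : 0 < length ys
  0<|ys| = subst (0 <_) (sym (trans (↭-length ys↭) (length-interval (suc m) r))) 0<r
  least⇒≡1 : All (y ≤_) xs → y ≡ 1
  least⇒≡1 y≤xs =
    ≤-antisym (All.lookup (∷ʳ⁺ y≤xs ≤-refl) (∈-resp-↭ (↭-sym block′) (here refl))) (proj₁ y-bounds)

avoids-++-1∷-reverse-interval : ∀ {b m} a r → xs ↭ interval b m → Avoids123 xs →
                                Avoids123 (xs ++ 1 ∷ reverse (interval a r))
avoids-++-1∷-reverse-interval a r xs↭ avoid = avoids-++-∷⁺ avoid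
  (All.tabulate λ x∈xs → ≤-trans (s≤s z≤n) (proj₁ (∈-interval⁻ _ _ (∈-resp-↭ xs↭ x∈xs))))
  (reverse-interval-nonincreasing a r)

lemma4p1 : (n : ℕ) (π : List ℕ) (i : ℕ) → IsPerm n π → IsFirstBlockEnd π i →
    (Avoids123 π × i ≢ n) ⇔
    ((1 ≤ i × i ≤ n ∸ 1)
     × at π (i ∸ 1) ≡ 1
     × take (i ∸ 1) π ↭ interval 1 (i ∸ 1)
     × Avoids123 (take (i ∸ 1) π)
     × drop i π ≡ reverse (interval i (n ∸ i)))
lemma4p1 n π (suc m) perm (s≤s z≤n , block , _) = mk⇔
  (λ (avoid , i≢n) → let i<n = ≤∧≢⇒< i≤n i≢n in
    (s≤s z≤n , <⇒≤pred i<n) ,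
    avoider-block-decomposition (subst (_↭ _) (take-suc-at i≤|π|) block)
      (suffix-↭-interval perm block i≤n) (m<n⇒0<n∸m i<n) (subst Avoids123 π≡ avoid))
  (λ ((_ , i≤n∸1) , y≡1 , A↭ , avoid-A , D≡) →
    subst Avoids123 (sym (trans π≡ (cong₂ (λ y D → take m π ++ y ∷ D) y≡1 D≡)))
      (avoids-++-1∷-reverse-interval (suc m) (n ∸ suc m) A↭ avoid-A) ,
    λ { refl → <-irrefl refl i≤n∸1 })
  where
  i≤|π| : suc m ≤ length π
  i≤|π| = prefixIsBlock⇒≤length block
  π≡ : π ≡ take m π ++ at π m ∷ drop (suc m) π
  π≡ = take-at-drop i≤|π|
  i≤n : suc m ≤ n
  i≤n = subst (suc m ≤_) (trans (↭-length perm) (length-interval 0 n)) i≤|π|
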